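{- Let $m\geqslant 2$, let $x,y\in\mathcal{A}_m^*$ and $k\geqslant 1$. Then $x\sim_1 y$ if and only if $\sigma_m^k(x)\sim_{k+1}\sigma_m^k(y)$.
   Context: $\mathcal{A}_m=\{0,\ldots,m-1\}=\mathbb{Z}/m\mathbb{Z}$; $\sigma_m$ is the morphism $\sigma_m(i)=i\,(i+1)\cdots(i+m-1)$ (letters mod $m$). For words $u,w$, $\binom{u}{w}$ is the number of occurrences of $w$ as a (not necessarily contiguous) subword of $u$; $u\sim_k v$ iff $\binom{u}{z}=\binom{v}{z}$ for all words $z$ of length at most $k$ ($\sim_1$ is abelian equivalence). -}

module Defs where

open import Data.Nat using (ℕ; zero; suc; _+_; _≤_; NonZero)
open import Data.Nat.DivMod using (_%_; m%n<n)
open import Data.Fin using (Fin; toℕ; fromℕ<)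
open import Data.Fin.Properties using (_≟_)
open import Data.List using (List; []; _∷_; length; concatMap; map; upTo)
open import Relation.Nullary using (yes; no)
open import Relation.Binary.PropositionalEquality using (_≡_)

-- Alphabet A_m = Z/mZ, represented by Fin m; words are lists.
Word : ℕ → Set
Word m = List (Fin m)

_+ₘ_ : {m : ℕ} .{{_ : NonZero m}} → Fin m → ℕ → Fin m
_+ₘ_ {m} i j = fromℕ< (m%n<n (toℕ i + j) m)

σ-letter : (m : ℕ) .{{_ : NonZero m}} → Fin m → Word m
σ-letter m i = map (λ j → i +ₘ j) (upTo m)

σ : (m : ℕ) .{{_ : NonZero m}} → Word m → Word m
σ m = concatMap (σ-letter m)

σ^ : (m : ℕ) .{{_ : NonZero m}} → ℕ → Word m → Word m
σ^ m zero    w = w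
σ^ m (suc k) w = σ m (σ^ m k w)

-- binomial coefficient of words: number of occurrences of w as a
-- (scattered) subword of u
binom : {m : ℕ} → Word m → Word m → ℕ
binom u        []       = 1
binom []       (_ ∷ _)  = 0
binom (a ∷ u)  (b ∷ w) with a ≟ b
... | yes _ = binom u w + binom u (b ∷ w)
... | no  _ = binom u (b ∷ w)

_∼[_]_ : {m : ℕ} → Word m → ℕ → Word m → Set
_∼[_]_ {m} u k v = (z : Word m) → length z ≤ k → binom u z ≡ binom v z

-- x ∼₁ y makes x a permutation of y, so the forward direction reduces to one adjacent swap ab ↦ ba.
-- By induction on k, σᵏ(a) ∼ₖ σᵏ(b) (σ(a) and σ(b) are anagrams), and u ∼ₖ v gives uv ∼ₖ₊₁ vu:
-- binomial coefficients of a concatenation are a convolution _⋆_, and the commutator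
-- (u ⋆ v) − (v ⋆ u) only involves Δ u v, which vanishes on words of length at most k.
--
-- Conversely, for x, y of equal length and the run z = s (s+1) … (s+k),
--   binom(σᵏx, z) − binom(σᵏy, z) = βₖ (|x|_{s+k} − |y|_{s+k})   with βₖ ≠ 0,
-- and taking s + k = c recovers |x|_c = |y|_c. For the step,
-- σx and σy are anagrams, and by the leading term of the commutator each adjacent swap ab ↦ ba
-- changes binom(σᵏ ·, z) on runs of length k + 2 by m^(k-1) βₖ (Ψ_t a − Ψ_t b), where t = s + k and
-- Ψ_t counts t minus t + 1. Summed over swaps this is m^(k-1) βₖ times the change of an inversion
-- statistic T_t, and T_t(σx) = |x| − m |x|_{t+1}, so β_{k+1} = −m^k βₖ.

module Submission where

open import Defs
open import Data.Nat using (ℕ; zero; suc; _≤_; _<_; z≤n; s≤s; NonZero; ≢-nonZero⁻¹)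
import Data.Nat as ℕ
open import Data.Product using (_×_; _,_; ∃-syntax)
open import Data.Sum using (_⊎_; inj₁; inj₂)
open import Data.Fin using (Fin; toℕ)
open import Data.Fin.Properties using (_≟_)
open import Data.List using ([]; _∷_; _++_; _∷ʳ_; [_]; length)
open import Data.List.Relation.Unary.All using (All; []; _∷_)
open import Data.List.Membership.Propositional using (_∈_)
open import Data.List.Relation.Binary.Permutation.Propositional using (_↭_; ↭-refl; ↭-sym; ↭-trans)
import Data.List.Relation.Binary.Permutation.Propositional as ↭
open import Function using (_∘_)
open import Relation.Nullary using (yes; no; contradiction)
open import Relation.Binary.PropositionalEquality hiding ([_])

private variable
  m n : ℕ
  a b c : Fin m
  u v w x y : Word m

module _ where
  open import Data.Nat using (_+_)
  open import Data.Nat.Properties using (+-cancelˡ-≡; 0≢1+n)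
  open import Data.Nat.Tactic.RingSolver using (solve-∀)
  open import Data.List.Relation.Unary.Any using (here; there)
  open import Data.List.Membership.Propositional.Properties using (∈-∃++)
  open import Data.List.Relation.Binary.Permutation.Propositional.Properties using (shift)

  occ : Word m → Fin m → ℕ
  occ w c = binom w [ c ]

  binom-∷-≡ : ∀ (a : Fin m) u w → binom (a ∷ u) (a ∷ w) ≡ binom u w + binom u (a ∷ w)
  binom-∷-≡ a u w with a ≟ a
  ... | yes _   = refl
  ... | no a≢a = contradiction refl a≢a

  binom-∷-≢ : ∀ (u w : Word m) → a ≢ b → binom (a ∷ u) (b ∷ w) ≡ binom u (b ∷ w)
  binom-∷-≢ {a = a} {b} u w a≢b with a ≟ b
  ... | yes a≡b = contradiction a≡b a≢b
  ... | no _    = refl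

  binom-++-free : ∀ u (v w : Word m) → All (_≢ c) u → binom (u ++ v) (c ∷ w) ≡ binom v (c ∷ w)
  binom-++-free []      v w []            = refl
  binom-++-free (a ∷ u) v w (a≢c ∷ u-free) = trans (binom-∷-≢ (u ++ v) w a≢c) (binom-++-free u v w u-free)

  binom-free : ∀ (u w : Word m) → All (_≢ c) u → binom u (c ∷ w) ≡ 0
  binom-free []      w []            = refl
  binom-free (a ∷ u) w (a≢c ∷ u-free) = trans (binom-∷-≢ u w a≢c) (binom-free u w u-free)

  occ-++ : ∀ (u v : Word m) c → occ (u ++ v) c ≡ occ u c + occ v c
  occ-++ []      v c = refl
  occ-++ (a ∷ u) v c with a ≟ c
  ... | yes _ = cong suc (occ-++ u v c)
  ... | no  _ = occ-++ u v c

  ∈-of-occ : ∀ (w : Word m) {k} → occ w c ≡ suc k → c ∈ w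
  ∈-of-occ {c = c} (a ∷ w) eq with a ≟ c
  ... | yes a≡c = here (sym a≡c)
  ... | no  _   = there (∈-of-occ w eq)

  ↭-of-occ : ∀ (x y : Word m) → (∀ c → occ x c ≡ occ y c) → x ↭ y
  ↭-of-occ []      []      _    = ↭-refl
  ↭-of-occ []      (c ∷ y) same = contradiction (trans (same c) (binom-∷-≡ c y [])) 0≢1+n
  ↭-of-occ (a ∷ x) y       same
    with ys , zs , refl ← ∈-∃++ (∈-of-occ y (trans (sym (same a)) (binom-∷-≡ a x [])))
    = ↭-trans (↭.prep a (↭-of-occ x (ys ++ zs) same′)) (↭-sym (shift a ys zs))
    where
    same′ : ∀ c → occ x c ≡ occ (ys ++ zs) c
    same′ c = +-cancelˡ-≡ (occ [ a ] c) _ _ (begin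
      occ [ a ] c + occ x c                    ≡⟨ occ-++ [ a ] x c ⟨
      occ (a ∷ x) c                            ≡⟨ same c ⟩
      occ (ys ++ a ∷ zs) c                     ≡⟨ occ-++ ys (a ∷ zs) c ⟩
      occ ys c + occ (a ∷ zs) c                ≡⟨ cong (occ ys c +_) (occ-++ [ a ] zs c) ⟩
      occ ys c + (occ [ a ] c + occ zs c)      ≡⟨ exchange (occ ys c) (occ [ a ] c) (occ zs c) ⟩
      occ [ a ] c + (occ ys c + occ zs c)      ≡⟨ cong (occ [ a ] c +_) (occ-++ ys zs c) ⟨
      occ [ a ] c + occ (ys ++ zs) c           ∎)
      where
      open ≡-Reasoning
      exchange : ∀ p q r → p + (q + r) ≡ q + (p + r)
      exchange = solve-∀

  ∼₁⇒↭ : x ∼[ 1 ] y → x ↭ y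
  ∼₁⇒↭ {x = x} {y = y} x∼y = ↭-of-occ x y (λ c → x∼y [ c ] (s≤s z≤n))

module _ where
  open import Data.Integer using (ℤ; +_; 0ℤ; 1ℤ; _+_; _*_; _-_)
  open import Data.Integer.Properties
    using ( pos-+; +-injective; i-j≡0⇒i≡j; i≡j⇒i-j≡0; +-inverseʳ
          ; *-identityˡ; *-identityʳ; *-zeroˡ; *-zeroʳ; +-identityˡ; +-identityʳ)
  open import Data.Integer.Tactic.RingSolver using (solve-∀)
  open import Data.Nat.Properties using (≤-trans; <⇒≤; m<n⇒m<1+n; n<1+n)
  open ≡-Reasoning

  binomℤ : Word m → Word m → ℤ
  binomℤ u w = + binom u w

  infixl 6 _-ᶠ_
  _-ᶠ_ : (f g : Word m → ℤ) → Word m → ℤ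
  (f -ᶠ g) w = f w - g w

  Δ : Word m → Word m → Word m → ℤ
  Δ u v = binomℤ u -ᶠ binomℤ v

  -- (f ⋆ g) z sums f z₁ * g z₂ over all factorisations z = z₁ z₂.
  infixl 7 _⋆_
  _⋆_ : (f g : Word m → ℤ) → Word m → ℤ
  (f ⋆ g) []      = f [] * g []
  (f ⋆ g) (c ∷ z) = f [] * g (c ∷ z) + ((f ∘ (c ∷_)) ⋆ g) z

  private variable f f′ g g′ e : Word m → ℤ

  ⋆-cong : f ≗ f′ → g ≗ g′ → f ⋆ g ≗ f′ ⋆ g′
  ⋆-cong f≗f′ g≗g′ []      = cong₂ _*_ (f≗f′ []) (g≗g′ [])
  ⋆-cong f≗f′ g≗g′ (c ∷ z) =
    cong₂ _+_ (cong₂ _*_ (f≗f′ []) (g≗g′ (c ∷ z))) (⋆-cong (f≗f′ ∘ (c ∷_)) g≗g′ z)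

  ⋆-distribʳ-+ : ∀ (f f′ g : Word m → ℤ) z → ((λ w → f w + f′ w) ⋆ g) z ≡ (f ⋆ g) z + (f′ ⋆ g) z
  ⋆-distribʳ-+ f f′ g []      = distrib (f []) (f′ []) (g [])
    where
    distrib : ∀ p q r → (p + q) * r ≡ p * r + q * r
    distrib = solve-∀
  ⋆-distribʳ-+ f f′ g (c ∷ z) =
    trans (cong (_+_ ((f [] + f′ []) * g (c ∷ z))) (⋆-distribʳ-+ (f ∘ (c ∷_)) (f′ ∘ (c ∷_)) g z))
          (distrib (f []) (f′ []) (g (c ∷ z)) (((f ∘ (c ∷_)) ⋆ g) z) (((f′ ∘ (c ∷_)) ⋆ g) z))
    where
    distrib : ∀ p q r s s′ → (p + q) * r + (s + s′) ≡ (p * r + s) + (q * r + s′)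
    distrib = solve-∀

  ⋆-distribʳ-minus : ∀ (f f′ g : Word m → ℤ) z → ((f -ᶠ f′) ⋆ g) z ≡ (f ⋆ g) z - (f′ ⋆ g) z
  ⋆-distribʳ-minus f f′ g []      = distrib (f []) (f′ []) (g [])
    where
    distrib : ∀ p q r → (p - q) * r ≡ p * r - q * r
    distrib = solve-∀
  ⋆-distribʳ-minus f f′ g (c ∷ z) =
    trans (cong (_+_ ((f [] - f′ []) * g (c ∷ z))) (⋆-distribʳ-minus (f ∘ (c ∷_)) (f′ ∘ (c ∷_)) g z))
          (distrib (f []) (f′ []) (g (c ∷ z)) (((f ∘ (c ∷_)) ⋆ g) z) (((f′ ∘ (c ∷_)) ⋆ g) z))
    where
    distrib : ∀ p q r s s′ → (p - q) * r + (s - s′) ≡ (p * r + s) - (q * r + s′)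
    distrib = solve-∀

  ⋆-distribˡ-minus : ∀ (g f f′ : Word m → ℤ) z → (g ⋆ (f -ᶠ f′)) z ≡ (g ⋆ f) z - (g ⋆ f′) z
  ⋆-distribˡ-minus g f f′ []      = distrib (g []) (f []) (f′ [])
    where
    distrib : ∀ p q r → p * (q - r) ≡ p * q - p * r
    distrib = solve-∀
  ⋆-distribˡ-minus g f f′ (c ∷ z) =
    trans (cong (_+_ (g [] * (f (c ∷ z) - f′ (c ∷ z)))) (⋆-distribˡ-minus (g ∘ (c ∷_)) f f′ z))
          (distrib (g []) (f (c ∷ z)) (f′ (c ∷ z)) (((g ∘ (c ∷_)) ⋆ f) z) (((g ∘ (c ∷_)) ⋆ f′) z))
    where
    distrib : ∀ p q r s s′ → p * (q - r) + (s - s′) ≡ (p * q + s) - (p * r + s′)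
    distrib = solve-∀

  VanishesBelow : ℕ → (Word m → ℤ) → Set
  VanishesBelow L e = ∀ w → length w < L → e w ≡ 0ℤ

  vanishesBelow-≤ : ∀ {L L′} → L ≤ L′ → VanishesBelow L′ e → VanishesBelow L e
  vanishesBelow-≤ L≤L′ e≈0 w lw = e≈0 w (≤-trans lw L≤L′)

  ⋆-vanishingˡ : ∀ e (g : Word m → ℤ) z → VanishesBelow (length z) e → (e ⋆ g) z ≡ e z * g []
  ⋆-vanishingˡ e g []      _   = refl
  ⋆-vanishingˡ e g (c ∷ z) e≈0 = begin
    e [] * g (c ∷ z) + ((e ∘ (c ∷_)) ⋆ g) z ≡⟨ cong₂ _+_ (cong (_* g (c ∷ z)) (e≈0 [] (s≤s z≤n)))
                                                        (⋆-vanishingˡ (e ∘ (c ∷_)) g z (λ w → e≈0 (c ∷ w) ∘ s≤s)) ⟩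
    0ℤ * g (c ∷ z) + e (c ∷ z) * g []       ≡⟨ cong (_+ e (c ∷ z) * g []) (*-zeroˡ (g (c ∷ z))) ⟩
    0ℤ + e (c ∷ z) * g []                   ≡⟨ +-identityˡ _ ⟩
    e (c ∷ z) * g []                        ∎

  ⋆-vanishingʳ : ∀ (g e : Word m → ℤ) z → VanishesBelow (length z) e → (g ⋆ e) z ≡ g [] * e z
  ⋆-vanishingʳ g e []      _   = refl
  ⋆-vanishingʳ g e (c ∷ z) e≈0 = begin
    g [] * e (c ∷ z) + ((g ∘ (c ∷_)) ⋆ e) z ≡⟨ cong (_+_ (g [] * e (c ∷ z)))
                                                   (⋆-vanishingʳ (g ∘ (c ∷_)) e z (λ w → e≈0 w ∘ m<n⇒m<1+n)) ⟩
    g [] * e (c ∷ z) + g [ c ] * e z        ≡⟨ cong (λ r → g [] * e (c ∷ z) + g [ c ] * r) (e≈0 z (n<1+n _)) ⟩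
    g [] * e (c ∷ z) + g [ c ] * 0ℤ         ≡⟨ cong (_+_ (g [] * e (c ∷ z))) (*-zeroʳ (g [ c ])) ⟩
    g [] * e (c ∷ z) + 0ℤ                   ≡⟨ +-identityʳ _ ⟩
    g [] * e (c ∷ z)                        ∎

  ⋆-vanishingʳ-∷ : ∀ (g e : Word m → ℤ) c z → VanishesBelow (length z) e →
                   (g ⋆ e) (c ∷ z) ≡ g [] * e (c ∷ z) + g [ c ] * e z
  ⋆-vanishingʳ-∷ g e c z e≈0 = cong (_+_ (g [] * e (c ∷ z))) (⋆-vanishingʳ (g ∘ (c ∷_)) e z e≈0)

  ⋆-vanishingˡ-∷ʳ : ∀ (e g : Word m → ℤ) z d → VanishesBelow (length z) e →
                    (e ⋆ g) (z ∷ʳ d) ≡ e z * g [ d ] + e (z ∷ʳ d) * g []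
  ⋆-vanishingˡ-∷ʳ e g []      d _   = refl
  ⋆-vanishingˡ-∷ʳ e g (c ∷ z) d e≈0 = begin
    e [] * g (c ∷ z ∷ʳ d) + ((e ∘ (c ∷_)) ⋆ g) (z ∷ʳ d)
      ≡⟨ cong₂ _+_ (cong (_* g (c ∷ z ∷ʳ d)) (e≈0 [] (s≤s z≤n)))
                   (⋆-vanishingˡ-∷ʳ (e ∘ (c ∷_)) g z d (λ w → e≈0 (c ∷ w) ∘ s≤s)) ⟩
    0ℤ * g (c ∷ z ∷ʳ d) + (e (c ∷ z) * g [ d ] + e (c ∷ z ∷ʳ d) * g [])
      ≡⟨ cong (_+ (e (c ∷ z) * g [ d ] + e (c ∷ z ∷ʳ d) * g [])) (*-zeroˡ (g (c ∷ z ∷ʳ d))) ⟩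
    0ℤ + (e (c ∷ z) * g [ d ] + e (c ∷ z ∷ʳ d) * g [])
      ≡⟨ +-identityˡ _ ⟩
    e (c ∷ z) * g [ d ] + e (c ∷ z ∷ʳ d) * g [] ∎

  ⋆-identityˡ : ∀ (g : Word m → ℤ) → binomℤ [] ⋆ g ≗ g
  ⋆-identityˡ g []      = *-identityˡ (g [])
  ⋆-identityˡ g (c ∷ z) = begin
    1ℤ * g (c ∷ z) + ((λ _ → 0ℤ) ⋆ g) z
      ≡⟨ cong (_+_ (1ℤ * g (c ∷ z))) (⋆-vanishingˡ (λ _ → 0ℤ) g z (λ _ _ → refl)) ⟩
    1ℤ * g (c ∷ z) + 0ℤ * g []          ≡⟨ cong₂ _+_ (*-identityˡ (g (c ∷ z))) (*-zeroˡ (g [])) ⟩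
    g (c ∷ z) + 0ℤ                      ≡⟨ +-identityʳ (g (c ∷ z)) ⟩
    g (c ∷ z)                           ∎

  binomℤ-++ : ∀ (u v : Word m) → binomℤ (u ++ v) ≗ binomℤ u ⋆ binomℤ v
  binomℤ-++ []      v z       = sym (⋆-identityˡ (binomℤ v) z)
  binomℤ-++ (a ∷ u) v []      = refl
  binomℤ-++ (a ∷ u) v (c ∷ z) with a ≟ c
  ... | no  _    = binomℤ-++ u v (c ∷ z)
  ... | yes refl = begin
    + (binom (u ++ v) z ℕ.+ binom (u ++ v) (a ∷ z))    ≡⟨ pos-+ (binom (u ++ v) z) _ ⟩
    binomℤ (u ++ v) z + binomℤ (u ++ v) (a ∷ z)        ≡⟨ cong₂ _+_ (binomℤ-++ u v z) (binomℤ-++ u v (a ∷ z)) ⟩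
    (U ⋆ V) z + (1ℤ * V (a ∷ z) + (Uₐ ⋆ V) z)           ≡⟨ exchange ((U ⋆ V) z) (V (a ∷ z)) ((Uₐ ⋆ V) z) ⟩
    1ℤ * V (a ∷ z) + ((U ⋆ V) z + (Uₐ ⋆ V) z)           ≡⟨ cong (_+_ (1ℤ * V (a ∷ z))) (⋆-distribʳ-+ U Uₐ V z) ⟨
    1ℤ * V (a ∷ z) + ((λ w → U w + Uₐ w) ⋆ V) z
      ≡⟨ cong (_+_ (1ℤ * V (a ∷ z))) (⋆-cong (λ w → sym (pos-+ (binom u w) _)) (λ _ → refl) z) ⟩
    -- binomℤ (a ∷ u) ∘ (a ∷_), unfolded along the abstracted a ≟ a
    1ℤ * V (a ∷ z) + ((λ w → + (binom u w ℕ.+ binom u (a ∷ w))) ⋆ V) z ∎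
    where
    U V Uₐ : Word _ → ℤ
    U  = binomℤ u
    V  = binomℤ v
    Uₐ = U ∘ (a ∷_)
    exchange : ∀ p q r → p + (1ℤ * q + r) ≡ 1ℤ * q + (p + r)
    exchange = solve-∀

  Δ-self : ∀ (u z : Word m) → Δ u u z ≡ 0ℤ
  Δ-self u z = +-inverseʳ (binomℤ u z)

  ∼⇒vanishes : u ∼[ n ] v → VanishesBelow (suc n) (Δ u v)
  ∼⇒vanishes u∼v w (s≤s lw) = i≡j⇒i-j≡0 (cong +_ (u∼v w lw))

  vanishes⇒∼ : VanishesBelow (suc n) (Δ u v) → u ∼[ n ] v
  vanishes⇒∼ Δ≈0 w lw = +-injective (i-j≡0⇒i≡j _ _ (Δ≈0 w (s≤s lw)))

  ∼-refl : u ∼[ n ] u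
  ∼-refl _ _ = refl

  ∼-trans : u ∼[ n ] v → v ∼[ n ] w → u ∼[ n ] w
  ∼-trans u∼v v∼w z lz = trans (u∼v z lz) (v∼w z lz)

  Δ-++ : ∀ (u u′ v v′ z : Word m) → VanishesBelow (length z) (Δ u u′) → VanishesBelow (length z) (Δ v v′) →
         Δ (u ++ v) (u′ ++ v′) z ≡ Δ u u′ z + Δ v v′ z
  Δ-++ u u′ v v′ z Δu≈0 Δv≈0 = begin
    Δ (u ++ v) (u′ ++ v′) z                      ≡⟨ cong₂ _-_ (binomℤ-++ u v z) (binomℤ-++ u′ v′ z) ⟩
    (U ⋆ V) z - (U′ ⋆ V′) z                      ≡⟨ telescope ((U ⋆ V) z) ((U′ ⋆ V) z) ((U′ ⋆ V′) z) ⟩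
    ((U ⋆ V) z - (U′ ⋆ V) z) + ((U′ ⋆ V) z - (U′ ⋆ V′) z)
      ≡⟨ cong₂ _+_ (⋆-distribʳ-minus U U′ V z) (⋆-distribˡ-minus U′ V V′ z) ⟨
    (Δ u u′ ⋆ V) z + (U′ ⋆ Δ v v′) z
      ≡⟨ cong₂ _+_ (⋆-vanishingˡ (Δ u u′) V z Δu≈0) (⋆-vanishingʳ U′ (Δ v v′) z Δv≈0) ⟩
    Δ u u′ z * 1ℤ + 1ℤ * Δ v v′ z                ≡⟨ cong₂ _+_ (*-identityʳ (Δ u u′ z)) (*-identityˡ (Δ v v′ z)) ⟩
    Δ u u′ z + Δ v v′ z                          ∎
    where
    U U′ V V′ : Word _ → ℤ
    U  = binomℤ u
    U′ = binomℤ u′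
    V  = binomℤ v
    V′ = binomℤ v′
    telescope : ∀ p q r → p - r ≡ (p - q) + (q - r)
    telescope = solve-∀

  ∼-++ : u ∼[ n ] v → x ∼[ n ] y → (u ++ x) ∼[ n ] (v ++ y)
  ∼-++ {u = u} {n = n} {v = v} {x = x} {y = y} u∼v x∼y = vanishes⇒∼ λ z lz → begin
    Δ (u ++ x) (v ++ y) z ≡⟨ Δ-++ u v x y z (below z u∼v lz) (below z x∼y lz) ⟩
    Δ u v z + Δ x y z     ≡⟨ cong₂ _+_ (∼⇒vanishes u∼v z lz) (∼⇒vanishes x∼y z lz) ⟩
    0ℤ                    ∎
    where
    below : ∀ {p q} z → p ∼[ n ] q → length z < suc n → VanishesBelow (length z) (Δ p q)
    below z p∼q lz = vanishesBelow-≤ (<⇒≤ lz) (∼⇒vanishes p∼q)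

  ⋆-commutator : ∀ (f g : Word m → ℤ) z → (f ⋆ g) z - (g ⋆ f) z ≡ ((f -ᶠ g) ⋆ g) z - (g ⋆ (f -ᶠ g)) z
  ⋆-commutator f g z = begin
    (f ⋆ g) z - (g ⋆ f) z                               ≡⟨ shift ((f ⋆ g) z) ((g ⋆ f) z) ((g ⋆ g) z) ⟩
    ((f ⋆ g) z - (g ⋆ g) z) - ((g ⋆ f) z - (g ⋆ g) z)   ≡⟨ cong₂ _-_ (⋆-distribʳ-minus f g g z) (⋆-distribˡ-minus g f g z) ⟨
    ((f -ᶠ g) ⋆ g) z - (g ⋆ (f -ᶠ g)) z                 ∎
    where
    shift : ∀ p q r → p - q ≡ (p - r) - (q - r)
    shift = solve-∀

  Δ-++-comm : ∀ (u v z : Word m) → Δ (u ++ v) (v ++ u) z ≡ (Δ u v ⋆ binomℤ v) z - (binomℤ v ⋆ Δ u v) z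
  Δ-++-comm u v z = trans (cong₂ _-_ (binomℤ-++ u v z) (binomℤ-++ v u z)) (⋆-commutator (binomℤ u) (binomℤ v) z)

  ∼-swap : u ∼[ n ] v → (u ++ v) ∼[ suc n ] (v ++ u)
  ∼-swap {u = u} {v = v} u∼v = vanishes⇒∼ λ z lz → begin
    Δ (u ++ v) (v ++ u) z                       ≡⟨ Δ-++-comm u v z ⟩
    (Δ u v ⋆ binomℤ v) z - (binomℤ v ⋆ Δ u v) z ≡⟨ cong₂ _-_ (⋆-vanishingˡ (Δ u v) (binomℤ v) z (Δ≈0 z lz))
                                                            (⋆-vanishingʳ (binomℤ v) (Δ u v) z (Δ≈0 z lz)) ⟩
    Δ u v z * 1ℤ - 1ℤ * Δ u v z                 ≡⟨ cancel (Δ u v z) ⟩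
    0ℤ                                          ∎
    where
    Δ≈0 : ∀ z → length z < suc (suc _) → VanishesBelow (length z) (Δ u v)
    Δ≈0 z (s≤s lz) = vanishesBelow-≤ lz (∼⇒vanishes u∼v)
    cancel : ∀ p → p * 1ℤ - 1ℤ * p ≡ 0ℤ
    cancel = solve-∀

  Δ-++-comm-leading : ∀ (u v : Word m) {c d} pre suf → VanishesBelow (length pre) (Δ u v) →
                   length suf ≡ length pre → c ∷ suf ≡ pre ∷ʳ d →
                   Δ (u ++ v) (v ++ u) (c ∷ suf) ≡ Δ u v pre * binomℤ v [ d ] - binomℤ v [ c ] * Δ u v suf
  Δ-++-comm-leading u v {c} {d} pre suf Δ≈0 same-length c∷suf≡pre∷ʳd = begin
    Δ (u ++ v) (v ++ u) (c ∷ suf)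
      ≡⟨ Δ-++-comm u v (c ∷ suf) ⟩
    (δ ⋆ V) (c ∷ suf) - (V ⋆ δ) (c ∷ suf)
      ≡⟨ cong₂ _-_ (trans (cong (δ ⋆ V) c∷suf≡pre∷ʳd) (⋆-vanishingˡ-∷ʳ δ V pre d Δ≈0))
                   (⋆-vanishingʳ-∷ V δ c suf (subst (λ L → VanishesBelow L δ) (sym same-length) Δ≈0)) ⟩
    (δ pre * V [ d ] + δ (pre ∷ʳ d) * 1ℤ) - (1ℤ * δ (c ∷ suf) + V [ c ] * δ suf)
      ≡⟨ cong (λ r → (δ pre * V [ d ] + δ r * 1ℤ) - (1ℤ * δ (c ∷ suf) + V [ c ] * δ suf)) c∷suf≡pre∷ʳd ⟨
    (δ pre * V [ d ] + δ (c ∷ suf) * 1ℤ) - (1ℤ * δ (c ∷ suf) + V [ c ] * δ suf)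
      ≡⟨ cancel (δ pre * V [ d ]) (δ (c ∷ suf)) (V [ c ] * δ suf) ⟩
    δ pre * V [ d ] - V [ c ] * δ suf ∎
    where
    δ V : Word _ → ℤ
    δ = Δ u v
    V = binomℤ v
    cancel : ∀ p q r → (p + q * 1ℤ) - (1ℤ * q + r) ≡ p - r
    cancel = solve-∀

module _ {m : ℕ} .{{_ : NonZero m}} where
  open import Data.Nat using (_+_; _*_; _∸_)
  open import Data.Nat.Properties using (+-comm; +-assoc; m+[n∸m]≡n; m∸n+n≡m; m≤m*n; <⇒≤)
  open import Data.Nat.DivMod using (_%_; m%n<n; m%n%n≡m%n; %-distribˡ-+; [m+n]%n≡m%n; [m+kn]%n≡m%n; m<n⇒m%n≡m)
  open import Data.Fin.Properties using (toℕ-fromℕ<; toℕ-injective; toℕ<n)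
  open ≡-Reasoning

  private
    [i%m+j]%m : ∀ i j → (i % m + j) % m ≡ (i + j) % m
    [i%m+j]%m i j = begin
      (i % m + j) % m           ≡⟨ %-distribˡ-+ (i % m) j m ⟩
      (i % m % m + j % m) % m   ≡⟨ cong (λ r → (r + j % m) % m) (m%n%n≡m%n i m) ⟩
      (i % m + j % m) % m       ≡⟨ %-distribˡ-+ i j m ⟨
      (i + j) % m               ∎

    [i+j%m]%m : ∀ i j → (i + j % m) % m ≡ (i + j) % m
    [i+j%m]%m i j = begin
      (i + j % m) % m ≡⟨ cong (_% m) (+-comm i (j % m)) ⟩
      (j % m + i) % m ≡⟨ [i%m+j]%m j i ⟩
      (j + i) % m     ≡⟨ cong (_% m) (+-comm j i) ⟩
      (i + j) % m     ∎

    a+i+[m∸a]≡i+m : ∀ (a : Fin m) i → toℕ a + i + (m ∸ toℕ a) ≡ i + m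
    a+i+[m∸a]≡i+m a i = begin
      toℕ a + i + (m ∸ toℕ a)   ≡⟨ cong (_+ (m ∸ toℕ a)) (+-comm (toℕ a) i) ⟩
      i + toℕ a + (m ∸ toℕ a)   ≡⟨ +-assoc i (toℕ a) (m ∸ toℕ a) ⟩
      i + (toℕ a + (m ∸ toℕ a)) ≡⟨ cong (i +_) (m+[n∸m]≡n (<⇒≤ (toℕ<n a))) ⟩
      i + m                     ∎

  toℕ-+ₘ : ∀ (a : Fin m) i → toℕ (a +ₘ i) ≡ (toℕ a + i) % m
  toℕ-+ₘ a i = toℕ-fromℕ< _

  +ₘ-identityʳ : ∀ (a : Fin m) → a +ₘ 0 ≡ a
  +ₘ-identityʳ a = toℕ-injective (begin
    toℕ (a +ₘ 0)     ≡⟨ toℕ-+ₘ a 0 ⟩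
    (toℕ a + 0) % m  ≡⟨ cong (_% m) (+-comm (toℕ a) 0) ⟩
    toℕ a % m        ≡⟨ m<n⇒m%n≡m (toℕ<n a) ⟩
    toℕ a            ∎)

  +ₘ-assoc : ∀ (a : Fin m) i j → (a +ₘ i) +ₘ j ≡ a +ₘ (i + j)
  +ₘ-assoc a i j = toℕ-injective (begin
    toℕ ((a +ₘ i) +ₘ j)          ≡⟨ toℕ-+ₘ (a +ₘ i) j ⟩
    (toℕ (a +ₘ i) + j) % m       ≡⟨ cong (λ r → (r + j) % m) (toℕ-+ₘ a i) ⟩
    ((toℕ a + i) % m + j) % m    ≡⟨ [i%m+j]%m (toℕ a + i) j ⟩
    (toℕ a + i + j) % m          ≡⟨ cong (_% m) (+-assoc (toℕ a) i j) ⟩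
    (toℕ a + (i + j)) % m        ≡⟨ toℕ-+ₘ a (i + j) ⟨
    toℕ (a +ₘ (i + j))           ∎)

  +ₘ-suc : ∀ (a : Fin m) i → (a +ₘ i) +ₘ 1 ≡ a +ₘ suc i
  +ₘ-suc a i = trans (+ₘ-assoc a i 1) (cong (a +ₘ_) (+-comm i 1))

  +ₘ-period : ∀ (a : Fin m) q → a +ₘ (q * m) ≡ a
  +ₘ-period a q = toℕ-injective (begin
    toℕ (a +ₘ (q * m))     ≡⟨ toℕ-+ₘ a (q * m) ⟩
    (toℕ a + q * m) % m    ≡⟨ [m+kn]%n≡m%n (toℕ a) q m ⟩
    toℕ a % m              ≡⟨ m<n⇒m%n≡m (toℕ<n a) ⟩
    toℕ a                  ∎)

  -- the unique i < m with a +ₘ i ≡ b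
  offset : Fin m → Fin m → ℕ
  offset a b = (toℕ b + (m ∸ toℕ a)) % m

  offset<m : ∀ (a b : Fin m) → offset a b < m
  offset<m a b = m%n<n _ m

  +ₘ-offset : ∀ (a b : Fin m) → a +ₘ offset a b ≡ b
  +ₘ-offset a b = toℕ-injective (begin
    toℕ (a +ₘ offset a b)                   ≡⟨ toℕ-+ₘ a (offset a b) ⟩
    (toℕ a + offset a b) % m                ≡⟨ [i+j%m]%m (toℕ a) (toℕ b + (m ∸ toℕ a)) ⟩
    (toℕ a + (toℕ b + (m ∸ toℕ a))) % m     ≡⟨ cong (_% m) (+-assoc (toℕ a) (toℕ b) _) ⟨
    (toℕ a + toℕ b + (m ∸ toℕ a)) % m       ≡⟨ cong (_% m) (a+i+[m∸a]≡i+m a (toℕ b)) ⟩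
    (toℕ b + m) % m                         ≡⟨ [m+n]%n≡m%n (toℕ b) m ⟩
    toℕ b % m                               ≡⟨ m<n⇒m%n≡m (toℕ<n b) ⟩
    toℕ b                                   ∎)

  offset-+ₘ : ∀ (a : Fin m) {i} → i < m → offset a (a +ₘ i) ≡ i
  offset-+ₘ a {i} i<m = begin
    (toℕ (a +ₘ i) + (m ∸ toℕ a)) % m      ≡⟨ cong (λ r → (r + (m ∸ toℕ a)) % m) (toℕ-+ₘ a i) ⟩
    ((toℕ a + i) % m + (m ∸ toℕ a)) % m   ≡⟨ [i%m+j]%m (toℕ a + i) (m ∸ toℕ a) ⟩
    (toℕ a + i + (m ∸ toℕ a)) % m         ≡⟨ cong (_% m) (a+i+[m∸a]≡i+m a i) ⟩
    (i + m) % m                           ≡⟨ [m+n]%n≡m%n i m ⟩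
    i % m                                 ≡⟨ m<n⇒m%n≡m i<m ⟩
    i                                     ∎

  +ₘ-cancelˡ : ∀ (a : Fin m) {i j} → i < m → j < m → a +ₘ i ≡ a +ₘ j → i ≡ j
  +ₘ-cancelˡ a {i} {j} i<m j<m eq = begin
    i                  ≡⟨ offset-+ₘ a i<m ⟨
    offset a (a +ₘ i)  ≡⟨ cong (offset a) eq ⟩
    offset a (a +ₘ j)  ≡⟨ offset-+ₘ a j<m ⟩
    j                  ∎

  infixl 6 _-ₘ_
  _-ₘ_ : Fin m → ℕ → Fin m
  a -ₘ k = a +ₘ (k * m ∸ k)

  -ₘ-+ₘ : ∀ (a : Fin m) k → (a -ₘ k) +ₘ k ≡ a
  -ₘ-+ₘ a k = begin
    (a +ₘ (k * m ∸ k)) +ₘ k  ≡⟨ +ₘ-assoc a (k * m ∸ k) k ⟩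
    a +ₘ (k * m ∸ k + k)     ≡⟨ cong (a +ₘ_) (m∸n+n≡m (m≤m*n k m)) ⟩
    a +ₘ (k * m)             ≡⟨ +ₘ-period a k ⟩
    a                        ∎

module _ {m : ℕ} .{{_ : NonZero m}} where
  open import Data.Nat using (_+_; _*_; _^_)
  open import Data.Nat.Properties
    using (+-comm; +-suc; *-suc; *-zeroʳ; *-assoc; +-identityʳ; ≤-trans; m≤m+n; <⇒≢; m<n⇒m<1+n)
  import Data.Sum as Sum
  open import Data.List using (map; applyUpTo; concat)
  open import Data.List.Properties using (map-upTo; applyUpTo-∷ʳ; map-++; concat-++; length-++)
  open ≡-Reasoning

  run : Fin m → ℕ → Word m
  run a zero    = []
  run a (suc ℓ) = a ∷ run (a +ₘ 1) ℓ

  run-+ : ∀ (a : Fin m) i j → run a (i + j) ≡ run a i ++ run (a +ₘ i) j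
  run-+ a zero    j = cong (λ b → run b j) (sym (+ₘ-identityʳ a))
  run-+ a (suc i) j = cong (a ∷_) (trans (run-+ (a +ₘ 1) i j) (cong (λ b → run (a +ₘ 1) i ++ run b j) (+ₘ-assoc a 1 i)))

  run-∷ʳ : ∀ (a : Fin m) ℓ → run a (suc ℓ) ≡ run a ℓ ∷ʳ (a +ₘ ℓ)
  run-∷ʳ a ℓ = trans (cong (run a) (+-comm 1 ℓ)) (run-+ a ℓ 1)

  length-run : ∀ (a : Fin m) ℓ → length (run a ℓ) ≡ ℓ
  length-run a zero    = refl
  length-run a (suc ℓ) = cong suc (length-run (a +ₘ 1) ℓ)

  σ-letter≡run : ∀ (a : Fin m) → σ-letter m a ≡ run a m
  σ-letter≡run a = trans (map-upTo (a +ₘ_) m) (applyUpTo≡run m)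
    where
    applyUpTo≡run : ∀ ℓ → applyUpTo (a +ₘ_) ℓ ≡ run a ℓ
    applyUpTo≡run zero    = refl
    applyUpTo≡run (suc ℓ) = begin
      applyUpTo (a +ₘ_) (suc ℓ)         ≡⟨ applyUpTo-∷ʳ (a +ₘ_) ℓ ⟨
      applyUpTo (a +ₘ_) ℓ ∷ʳ (a +ₘ ℓ)   ≡⟨ cong (_∷ʳ (a +ₘ ℓ)) (applyUpTo≡run ℓ) ⟩
      run a ℓ ∷ʳ (a +ₘ ℓ)               ≡⟨ run-∷ʳ a ℓ ⟨
      run a (suc ℓ)                     ∎

  run-∌ : ∀ (a : Fin m) {b c i q} ℓ → b ≡ a +ₘ q → c ≡ a +ₘ i →
          i < m → q + ℓ ≤ m → i < q ⊎ q + ℓ ≤ i → All (_≢ c) (run b ℓ)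
  run-∌ a         zero    _    _    _   _     _       = []
  run-∌ a {i = i} {q} (suc ℓ) refl refl i<m q+ℓ≤m outside =
    q≢i ∘ +ₘ-cancelˡ a (≤-trans (m≤m+n (suc q) ℓ) q+ℓ≤m′) i<m
    ∷ run-∌ a ℓ (+ₘ-suc a q) refl i<m q+ℓ≤m′ (Sum.map m<n⇒m<1+n (subst (_≤ i) (+-suc q ℓ)) outside)
    where
    q+ℓ≤m′ : suc q + ℓ ≤ m
    q+ℓ≤m′ = subst (_≤ m) (+-suc q ℓ) q+ℓ≤m
    q≢i : q ≢ i
    q≢i = Sum.[ ≢-sym ∘ <⇒≢ , <⇒≢ ∘ q<i ]′ outside
      where
      q<i : q + suc ℓ ≤ i → q < i
      q<i q+ℓ≤i = ≤-trans (s≤s (m≤m+n q ℓ)) (subst (_≤ i) (+-suc q ℓ) q+ℓ≤i)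

  σ-++ : ∀ (u v : Word m) → σ m (u ++ v) ≡ σ m u ++ σ m v
  σ-++ u v = trans (cong concat (map-++ (σ-letter m) u v)) (sym (concat-++ (map (σ-letter m) u) (map (σ-letter m) v)))

  σ^-++ : ∀ k (u v : Word m) → σ^ m k (u ++ v) ≡ σ^ m k u ++ σ^ m k v
  σ^-++ zero    u v = refl
  σ^-++ (suc k) u v = trans (cong (σ m) (σ^-++ k u v)) (σ-++ (σ^ m k u) (σ^ m k v))

  σ^-suc : ∀ k (w : Word m) → σ^ m (suc k) w ≡ σ^ m k (σ m w)
  σ^-suc zero    w = refl
  σ^-suc (suc k) w = cong (σ m) (σ^-suc k w)

  length-σ : ∀ (w : Word m) → length (σ m w) ≡ m * length w
  length-σ []      = sym (*-zeroʳ m)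
  length-σ (a ∷ w) = begin
    length (σ-letter m a ++ σ m w)         ≡⟨ length-++ (σ-letter m a) ⟩
    length (σ-letter m a) + length (σ m w)
      ≡⟨ cong₂ _+_ (trans (cong length (σ-letter≡run a)) (length-run a m)) (length-σ w) ⟩
    m + m * length w                       ≡⟨ *-suc m (length w) ⟨
    m * suc (length w)                     ∎

  length-σ^ : ∀ k (w : Word m) → length (σ^ m k w) ≡ m ^ k * length w
  length-σ^ zero    w = sym (+-identityʳ (length w))
  length-σ^ (suc k) w = begin
    length (σ m (σ^ m k w))  ≡⟨ length-σ (σ^ m k w) ⟩
    m * length (σ^ m k w)    ≡⟨ cong (m *_) (length-σ^ k w) ⟩
    m * (m ^ k * length w)   ≡⟨ *-assoc m (m ^ k) (length w) ⟨
    m ^ suc k * length w     ∎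

module _ {m : ℕ} .{{_ : NonZero m}} (1<m : 1 < m) where

  module _ where
    open import Data.Nat using (_+_; _*_; _^_)
    open import Data.Nat.Properties
      using ( +-suc; +-identityʳ; *-identityˡ; <⇒≤; ≤-refl; ≤-reflexive; ≤-trans
            ; n≤1+n; m≤m+n; n<1+n; <-irrefl; 0≢1+n; m+[n∸m]≡n)
    open ≡-Reasoning

    private
      0<m : 0 < m
      0<m = <⇒≤ 1<m

    +ₘ1≢ : ∀ (t : Fin m) → t +ₘ 1 ≢ t
    +ₘ1≢ t eq = 0≢1+n (sym (+ₘ-cancelˡ t 1<m 0<m (trans eq (sym (+ₘ-identityʳ t)))))

    Avoids : Fin m → Word m → Set
    Avoids t w = All (_≢ t) w × All (_≢ t +ₘ 1) w

    -- Where t and t +ₘ 1 sit in σ(a) = a (a + 1) … (a + m - 1): adjacent, or at the two ends.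
    data Split (a t : Fin m) : Set where
      inner : ∀ P Q → a ≢ t +ₘ 1 → Avoids t P → Avoids t Q → run a m ≡ P ++ t ∷ t +ₘ 1 ∷ Q → Split a t
      outer : ∀ Q → a ≡ t +ₘ 1 → Avoids t Q → run a m ≡ t +ₘ 1 ∷ (Q ∷ʳ t) → Split a t

    split-inner : ∀ (a : Fin m) i r → suc i + suc r ≡ m → Split a (a +ₘ i)
    split-inner a i r i+r≡m = inner (run a i) (run (a +ₘ suc (suc i)) r) a≢ (Pˡ , Pʳ) (Qˡ , Qʳ) run≡
      where
      i+2+r≡m : suc (suc i) + r ≡ m
      i+2+r≡m = trans (sym (+-suc (suc i) r)) i+r≡m
      i+1<m : suc i < m
      i+1<m = subst (suc (suc i) ≤_) i+2+r≡m (m≤m+n (suc (suc i)) r)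
      i<m : i < m
      i<m = <⇒≤ i+1<m
      a≢ : a ≢ (a +ₘ i) +ₘ 1
      a≢ eq = 0≢1+n (+ₘ-cancelˡ a 0<m i+1<m (trans (+ₘ-identityʳ a) (trans eq (+ₘ-suc a i))))
      Pˡ : All (_≢ a +ₘ i) (run a i)
      Pˡ = run-∌ a i (sym (+ₘ-identityʳ a)) refl i<m (<⇒≤ i<m) (inj₂ ≤-refl)
      Pʳ : All (_≢ (a +ₘ i) +ₘ 1) (run a i)
      Pʳ = run-∌ a i (sym (+ₘ-identityʳ a)) (+ₘ-suc a i) i+1<m (<⇒≤ i<m) (inj₂ (n≤1+n i))
      Qˡ : All (_≢ a +ₘ i) (run (a +ₘ suc (suc i)) r)
      Qˡ = run-∌ a r refl refl i<m (≤-reflexive i+2+r≡m) (inj₁ (≤-trans (n<1+n i) (n≤1+n (suc i))))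
      Qʳ : All (_≢ (a +ₘ i) +ₘ 1) (run (a +ₘ suc (suc i)) r)
      Qʳ = run-∌ a r refl (+ₘ-suc a i) i+1<m (≤-reflexive i+2+r≡m) (inj₁ ≤-refl)
      run≡ : run a m ≡ run a i ++ a +ₘ i ∷ (a +ₘ i) +ₘ 1 ∷ run (a +ₘ suc (suc i)) r
      run≡ = begin
        run a m                               ≡⟨ cong (run a) (trans (sym i+r≡m) (sym (+-suc i (suc r)))) ⟩
        run a (i + suc (suc r))               ≡⟨ run-+ a i (suc (suc r)) ⟩
        run a i ++ run (a +ₘ i) (suc (suc r)) ≡⟨ cong (λ b → run a i ++ a +ₘ i ∷ (a +ₘ i) +ₘ 1 ∷ run b r)
                                                      (trans (cong (_+ₘ 1) (+ₘ-suc a i)) (+ₘ-suc a (suc i))) ⟩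
        run a i ++ a +ₘ i ∷ (a +ₘ i) +ₘ 1 ∷ run (a +ₘ suc (suc i)) r ∎

    split-outer : ∀ (a : Fin m) i → suc (suc i) ≡ m → Split a (a +ₘ suc i)
    split-outer a i i+2≡m = outer (run (a +ₘ 1) i) a≡ (Qˡ , Qʳ) run≡
      where
      a≡ : a ≡ (a +ₘ suc i) +ₘ 1
      a≡ = sym (begin
        (a +ₘ suc i) +ₘ 1   ≡⟨ +ₘ-suc a (suc i) ⟩
        a +ₘ suc (suc i)    ≡⟨ cong (a +ₘ_) (trans i+2≡m (sym (*-identityˡ m))) ⟩
        a +ₘ (1 * m)        ≡⟨ +ₘ-period a 1 ⟩
        a                   ∎)
      Qˡ : All (_≢ a +ₘ suc i) (run (a +ₘ 1) i)
      Qˡ = run-∌ a i refl refl (≤-reflexive i+2≡m) (<⇒≤ (≤-reflexive i+2≡m)) (inj₂ ≤-refl)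
      Qʳ : All (_≢ (a +ₘ suc i) +ₘ 1) (run (a +ₘ 1) i)
      Qʳ = run-∌ a i refl (trans (sym a≡) (sym (+ₘ-identityʳ a))) 0<m (<⇒≤ (≤-reflexive i+2≡m)) (inj₁ ≤-refl)
      run≡ : run a m ≡ (a +ₘ suc i) +ₘ 1 ∷ (run (a +ₘ 1) i ∷ʳ a +ₘ suc i)
      run≡ = begin
        run a m                                      ≡⟨ cong (run a) (sym i+2≡m) ⟩
        a ∷ run (a +ₘ 1) (suc i)                     ≡⟨ cong₂ _∷_ a≡ (run-∷ʳ (a +ₘ 1) i) ⟩
        (a +ₘ suc i) +ₘ 1 ∷ (run (a +ₘ 1) i ∷ʳ (a +ₘ 1) +ₘ i)
          ≡⟨ cong (λ b → (a +ₘ suc i) +ₘ 1 ∷ (run (a +ₘ 1) i ∷ʳ b)) (+ₘ-assoc a 1 i) ⟩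
        (a +ₘ suc i) +ₘ 1 ∷ (run (a +ₘ 1) i ∷ʳ a +ₘ suc i) ∎

    split : ∀ (a t : Fin m) → Split a t
    split a t = subst (Split a) (+ₘ-offset a t) (by-gap (offset a t) _ (m+[n∸m]≡n (offset<m a t)))
      where
      by-gap : ∀ i r → suc i + r ≡ m → Split a (a +ₘ i)
      by-gap i       (suc r) i+r≡m = split-inner a i r i+r≡m
      by-gap zero    zero    1≡m   = contradiction 1<m (<-irrefl 1≡m)
      by-gap (suc i) zero    i+r≡m = split-outer a i (trans (sym (+-identityʳ (suc (suc i)))) i+r≡m)

    occ-run : ∀ (a c : Fin m) → occ (run a m) c ≡ 1
    occ-run a c with split a c
    ... | inner P Q _ (P∌c , _) (Q∌c , _) run≡ = begin
      occ (run a m) c                    ≡⟨ cong (λ w → occ w c) run≡ ⟩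
      binom (P ++ c ∷ c +ₘ 1 ∷ Q) [ c ]  ≡⟨ binom-++-free P _ [] P∌c ⟩
      binom (c ∷ c +ₘ 1 ∷ Q) [ c ]       ≡⟨ binom-∷-≡ c _ [] ⟩
      suc (binom (c +ₘ 1 ∷ Q) [ c ])     ≡⟨ cong suc (trans (binom-∷-≢ Q [] (+ₘ1≢ c)) (binom-free Q [] Q∌c)) ⟩
      1                                  ∎
    ... | outer Q _ (Q∌c , _) run≡ = begin
      occ (run a m) c                    ≡⟨ cong (λ w → occ w c) run≡ ⟩
      binom (c +ₘ 1 ∷ (Q ∷ʳ c)) [ c ]    ≡⟨ binom-∷-≢ (Q ∷ʳ c) [] (+ₘ1≢ c) ⟩
      binom (Q ++ [ c ]) [ c ]           ≡⟨ binom-++-free Q [ c ] [] Q∌c ⟩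
      binom [ c ] [ c ]                  ≡⟨ binom-∷-≡ c [] [] ⟩
      1                                  ∎

    pair-run : ∀ (a s : Fin m) → binom (run a m) (s ∷ s +ₘ 1 ∷ []) + occ [ a ] (s +ₘ 1) ≡ 1
    pair-run a s with split a s
    ... | inner P Q a≢ (P∌s , _) (Q∌s , Q∌s+1) run≡ = begin
      binom (run a m) (s ∷ s +ₘ 1 ∷ []) + occ [ a ] (s +ₘ 1)
        ≡⟨ cong₂ _+_ (cong (λ w → binom w (s ∷ s +ₘ 1 ∷ [])) run≡) (binom-∷-≢ [] [] a≢) ⟩
      binom (P ++ s ∷ s +ₘ 1 ∷ Q) (s ∷ s +ₘ 1 ∷ []) + 0
        ≡⟨ trans (+-identityʳ _) (binom-++-free P _ _ P∌s) ⟩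
      binom (s ∷ s +ₘ 1 ∷ Q) (s ∷ s +ₘ 1 ∷ [])
        ≡⟨ binom-∷-≡ s _ _ ⟩
      binom (s +ₘ 1 ∷ Q) [ s +ₘ 1 ] + binom (s +ₘ 1 ∷ Q) (s ∷ s +ₘ 1 ∷ [])
        ≡⟨ cong₂ _+_ (binom-∷-≡ (s +ₘ 1) Q []) (binom-∷-≢ Q _ (+ₘ1≢ s)) ⟩
      suc (binom Q [ s +ₘ 1 ]) + binom Q (s ∷ s +ₘ 1 ∷ [])
        ≡⟨ cong₂ (λ p q → suc p + q) (binom-free Q [] Q∌s+1) (binom-free Q _ Q∌s) ⟩
      1 ∎
    ... | outer Q refl (Q∌s , _) run≡ = begin
      binom (run a m) (s ∷ s +ₘ 1 ∷ []) + occ [ s +ₘ 1 ] (s +ₘ 1)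
        ≡⟨ cong₂ _+_ (cong (λ w → binom w (s ∷ s +ₘ 1 ∷ [])) run≡) (binom-∷-≡ (s +ₘ 1) [] []) ⟩
      binom (s +ₘ 1 ∷ (Q ∷ʳ s)) (s ∷ s +ₘ 1 ∷ []) + 1
        ≡⟨ cong (_+ 1) (trans (binom-∷-≢ (Q ∷ʳ s) _ (+ₘ1≢ s)) (binom-++-free Q [ s ] _ Q∌s)) ⟩
      binom [ s ] (s ∷ s +ₘ 1 ∷ []) + 1
        ≡⟨ cong (_+ 1) (binom-∷-≡ s [] [ s +ₘ 1 ]) ⟩
      1 ∎

    occ-σ : ∀ (w : Word m) c → occ (σ m w) c ≡ length w
    occ-σ []      c = refl
    occ-σ (a ∷ w) c = begin
      occ (σ-letter m a ++ σ m w) c         ≡⟨ occ-++ (σ-letter m a) (σ m w) c ⟩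
      occ (σ-letter m a) c + occ (σ m w) c
        ≡⟨ cong₂ _+_ (trans (cong (λ u → occ u c) (σ-letter≡run a)) (occ-run a c)) (occ-σ w c) ⟩
      suc (length w)                        ∎

    occ-σ^ : ∀ j (w : Word m) c → occ (σ^ m (suc j) w) c ≡ m ^ j * length w
    occ-σ^ j w c = trans (occ-σ (σ^ m j w) c) (length-σ^ j w)

    σ-↭ : ∀ {x y : Word m} → length x ≡ length y → σ m x ↭ σ m y
    σ-↭ {x} {y} same = ↭-of-occ (σ m x) (σ m y) (λ c → trans (occ-σ x c) (trans same (sym (occ-σ y c))))

    σ^-∷-∷ : ∀ k (a b : Fin m) w → σ^ m k (a ∷ b ∷ w) ≡ (σ^ m k [ a ] ++ σ^ m k [ b ]) ++ σ^ m k w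
    σ^-∷-∷ k a b w = trans (σ^-++ k (a ∷ b ∷ []) w) (cong (_++ σ^ m k w) (σ^-++ k [ a ] [ b ]))

    σ^-letters-∼ : ∀ k (a b : Fin m) → σ^ m k [ a ] ∼[ k ] σ^ m k [ b ]
    σ^-↭-∼ : ∀ k {x y : Word m} → x ↭ y → σ^ m k x ∼[ suc k ] σ^ m k y

    σ^-letters-∼ zero    a b []      _  = refl
    σ^-letters-∼ zero    a b (_ ∷ _) ()
    σ^-letters-∼ (suc k) a b            =
      subst₂ (λ u v → u ∼[ suc k ] v) (sym (σ^-suc k [ a ])) (sym (σ^-suc k [ b ]))
             (σ^-↭-∼ k (σ-↭ {[ a ]} {[ b ]} refl))

    σ^-↭-∼ k ↭.refl         = ∼-refl
    σ^-↭-∼ k (↭.prep a p)   = subst₂ (λ u v → u ∼[ suc k ] v) (sym (σ^-++ k [ a ] _)) (sym (σ^-++ k [ a ] _))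
                                      (∼-++ ∼-refl (σ^-↭-∼ k p))
    σ^-↭-∼ k (↭.swap a b p) = subst₂ (λ u v → u ∼[ suc k ] v) (sym (σ^-∷-∷ k a b _)) (sym (σ^-∷-∷ k b a _))
                                      (∼-++ (∼-swap (σ^-letters-∼ k a b)) (σ^-↭-∼ k p))
    σ^-↭-∼ k (↭.trans p q)  = ∼-trans (σ^-↭-∼ k p) (σ^-↭-∼ k q)

  module _ where
    open import Data.Nat using (_^_)
    open import Data.Nat.Properties using (suc-injective; *-cancelˡ-≡; m^n≢0; *-identityʳ; ≤-reflexive)
    open import Data.Integer using (ℤ; +_; -_; 0ℤ; 1ℤ; _+_; _*_; _-_)
    open import Data.Integer.Properties
      using (pos-+; +-injective; neg-injective; +-identityˡ; *-zeroʳ; i*j≡0⇒i≡0∨j≡0; i≡j⇒i-j≡0; i-j≡0⇒i≡j)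
    open import Data.Integer.Tactic.RingSolver using (solve-∀)
    open import Data.List.Properties using (length-++)
    open import Data.List.Relation.Binary.Permutation.Propositional.Properties using (↭-length)
    import Data.Sum as Sum
    open ≡-Reasoning

    Ψ : Fin m → Word m → ℤ
    Ψ t w = + occ w t - + occ w (t +ₘ 1)

    -- An adjacent swap ab ↦ ba changes T t by Ψ t [ a ] - Ψ t [ b ], matching Δ-σ^-swap-letters.
    T : Fin m → Word m → ℤ
    T t []      = 0ℤ
    T t (d ∷ w) = Ψ t [ d ] * + length w + T t w

    +occ-++ : ∀ (u v : Word m) c → + occ (u ++ v) c ≡ + occ u c + + occ v c
    +occ-++ u v c = trans (cong +_ (occ-++ u v c)) (pos-+ (occ u c) (occ v c))

    Ψ-++ : ∀ t (u v : Word m) → Ψ t (u ++ v) ≡ Ψ t u + Ψ t v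
    Ψ-++ t u v = begin
      + occ (u ++ v) t - + occ (u ++ v) (t +ₘ 1)
        ≡⟨ cong₂ _-_ (+occ-++ u v t) (+occ-++ u v (t +ₘ 1)) ⟩
      (+ occ u t + + occ v t) - (+ occ u (t +ₘ 1) + + occ v (t +ₘ 1))
        ≡⟨ regroup (+ occ u t) (+ occ v t) (+ occ u (t +ₘ 1)) (+ occ v (t +ₘ 1)) ⟩
      Ψ t u + Ψ t v ∎
      where
      regroup : ∀ p q p′ q′ → (p + q) - (p′ + q′) ≡ (p - p′) + (q - q′)
      regroup = solve-∀

    Ψ-avoids : ∀ {t} (w : Word m) → Avoids t w → Ψ t w ≡ 0ℤ
    Ψ-avoids w (w∌t , w∌t+1) = cong₂ (λ p q → + p - + q) (binom-free w [] w∌t) (binom-free w [] w∌t+1)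

    Ψ-run : ∀ t (a : Fin m) → Ψ t (run a m) ≡ 0ℤ
    Ψ-run t a = cong₂ (λ p q → + p - + q) (occ-run a t) (occ-run a (t +ₘ 1))

    Ψ-[t] : ∀ t → Ψ t [ t ] ≡ 1ℤ
    Ψ-[t] t = cong₂ (λ p q → + p - + q) (binom-∷-≡ t [] []) (binom-∷-≢ [] [] (≢-sym (+ₘ1≢ t)))

    Ψ-[t+1] : ∀ t → Ψ t [ t +ₘ 1 ] ≡ - 1ℤ
    Ψ-[t+1] t = cong₂ (λ p q → + p - + q) (binom-∷-≢ [] [] (+ₘ1≢ t)) (binom-∷-≡ (t +ₘ 1) [] [])

    T-++ : ∀ t (u v : Word m) → T t (u ++ v) ≡ T t u + Ψ t u * + length v + T t v
    T-++ t []      v = sym (vanish (+ length v) (T t v))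
      where
      vanish : ∀ p x → 0ℤ + 0ℤ * p + x ≡ x
      vanish = solve-∀
    T-++ t (d ∷ u) v = begin
      Ψ t [ d ] * + length (u ++ v) + T t (u ++ v)
        ≡⟨ cong₂ (λ p q → Ψ t [ d ] * p + q) (trans (cong +_ (length-++ u)) (pos-+ (length u) _)) (T-++ t u v) ⟩
      Ψ t [ d ] * (+ length u + + length v) + (T t u + Ψ t u * + length v + T t v)
        ≡⟨ regroup (Ψ t [ d ]) (+ length u) (+ length v) (T t u) (Ψ t u) (T t v) ⟩
      Ψ t [ d ] * + length u + T t u + (Ψ t [ d ] + Ψ t u) * + length v + T t v
        ≡⟨ cong (λ p → Ψ t [ d ] * + length u + T t u + p * + length v + T t v) (Ψ-++ t [ d ] u) ⟨
      T t (d ∷ u) + Ψ t (d ∷ u) * + length v + T t v ∎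
      where
      regroup : ∀ p a b x y w → p * (a + b) + (x + y * b + w) ≡ p * a + x + (p + y) * b + w
      regroup = solve-∀

    T-avoids : ∀ {t} (w : Word m) → Avoids t w → T t w ≡ 0ℤ
    T-avoids []      _                               = refl
    T-avoids (d ∷ w) (d≢t ∷ w∌t , d≢t+1 ∷ w∌t+1) =
      cong₂ (λ p q → p * + length w + q) (Ψ-avoids [ d ] (d≢t ∷ [] , d≢t+1 ∷ [])) (T-avoids w (w∌t , w∌t+1))

    T-run : ∀ t (a : Fin m) → T t (run a m) ≡ 1ℤ - + m * + occ [ a ] (t +ₘ 1)
    T-run t a with split a t
    ... | inner P Q a≢ P∌ Q∌ run≡ = begin
      T t (run a m)                                           ≡⟨ cong (T t) run≡ ⟩
      T t (P ++ t ∷ t +ₘ 1 ∷ Q)                               ≡⟨ T-++ t P _ ⟩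
      T t P + Ψ t P * + L + (Ψ t [ t ] * + suc (length Q) + (Ψ t [ t +ₘ 1 ] * + length Q + T t Q))
        ≡⟨ cong₂ (λ p q → p + q * + L + _) (T-avoids P P∌) (Ψ-avoids P P∌) ⟩
      0ℤ + 0ℤ * + L + (Ψ t [ t ] * + suc (length Q) + (Ψ t [ t +ₘ 1 ] * + length Q + T t Q))
        ≡⟨ cong₂ (λ p q → 0ℤ + 0ℤ * + L + (p * + suc (length Q) + q)) (Ψ-[t] t)
                 (cong₂ (λ p q → p * + length Q + q) (Ψ-[t+1] t) (T-avoids Q Q∌)) ⟩
      0ℤ + 0ℤ * + L + (1ℤ * (1ℤ + + length Q) + (- 1ℤ * + length Q + 0ℤ))
        ≡⟨ telescope (+ L) (+ length Q) (+ m) ⟩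
      1ℤ - + m * + 0                                          ≡⟨ cong (λ n → 1ℤ - + m * + n) (binom-∷-≢ [] [] a≢) ⟨
      1ℤ - + m * + occ [ a ] (t +ₘ 1)                         ∎
      where
      L = length (t ∷ t +ₘ 1 ∷ Q)
      telescope : ∀ l q n → 0ℤ + 0ℤ * l + (1ℤ * (1ℤ + q) + (- 1ℤ * q + 0ℤ)) ≡ 1ℤ - n * 0ℤ
      telescope = solve-∀
    ... | outer Q refl Q∌ run≡ = begin
      T t (run a m)                                           ≡⟨ cong (T t) run≡ ⟩
      Ψ t [ t +ₘ 1 ] * + length (Q ∷ʳ t) + T t (Q ∷ʳ t)
        ≡⟨ cong₂ (λ p q → p * + length (Q ∷ʳ t) + q) (Ψ-[t+1] t) (T-++ t Q [ t ]) ⟩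
      - 1ℤ * + length (Q ∷ʳ t) + (T t Q + Ψ t Q * 1ℤ + (Ψ t [ t ] * 0ℤ + 0ℤ))
        ≡⟨ cong₂ (λ p q → - 1ℤ * + length (Q ∷ʳ t) + (p + q * 1ℤ + (Ψ t [ t ] * 0ℤ + 0ℤ)))
                 (T-avoids Q Q∌) (Ψ-avoids Q Q∌) ⟩
      - 1ℤ * + length (Q ∷ʳ t) + (0ℤ + 0ℤ * 1ℤ + (Ψ t [ t ] * 0ℤ + 0ℤ))
        ≡⟨ wrap-around (+ length (Q ∷ʳ t)) (Ψ t [ t ]) ⟩
      1ℤ - (1ℤ + + length (Q ∷ʳ t)) * 1ℤ
        ≡⟨ cong₂ (λ n i → 1ℤ - + n * + i) m≡ (binom-∷-≡ (t +ₘ 1) [] []) ⟨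
      1ℤ - + m * + occ [ t +ₘ 1 ] (t +ₘ 1)                    ∎
      where
      m≡ : m ≡ suc (length (Q ∷ʳ t))
      m≡ = trans (sym (length-run (t +ₘ 1) m)) (cong length run≡)
      wrap-around : ∀ l p → - 1ℤ * l + (0ℤ + 0ℤ * 1ℤ + (p * 0ℤ + 0ℤ)) ≡ 1ℤ - (1ℤ + l) * 1ℤ
      wrap-around = solve-∀

    T-σ : ∀ t (x : Word m) → T t (σ m x) ≡ + length x - + m * + occ x (t +ₘ 1)
    T-σ t []      = sym (cong (_-_ 0ℤ) (*-zeroʳ (+ m)))
    T-σ t (a ∷ x) = begin
      T t (σ-letter m a ++ σ m x)
        ≡⟨ T-++ t (σ-letter m a) (σ m x) ⟩
      T t (σ-letter m a) + Ψ t (σ-letter m a) * + length (σ m x) + T t (σ m x)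
        ≡⟨ cong (λ w → T t w + Ψ t w * + length (σ m x) + T t (σ m x)) (σ-letter≡run a) ⟩
      T t (run a m) + Ψ t (run a m) * + length (σ m x) + T t (σ m x)
        ≡⟨ cong₂ _+_ (cong₂ (λ p q → p + q * + length (σ m x)) (T-run t a) (Ψ-run t a)) (T-σ t x) ⟩
      (1ℤ - + m * A) + 0ℤ * + length (σ m x) + (+ length x - + m * X)
        ≡⟨ regroup (+ m) A (+ length (σ m x)) (+ length x) X ⟩
      (1ℤ + + length x) - + m * (A + X)
        ≡⟨ cong (λ p → (1ℤ + + length x) - + m * p) (+occ-++ [ a ] x (t +ₘ 1)) ⟨
      + length (a ∷ x) - + m * + occ (a ∷ x) (t +ₘ 1) ∎
      where
      A = + occ [ a ] (t +ₘ 1)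
      X = + occ x (t +ₘ 1)
      regroup : ∀ n i l l′ c → (1ℤ - n * i) + 0ℤ * l + (l′ - n * c) ≡ (1ℤ + l′) - n * (i + c)
      regroup = solve-∀

    T-prep : ∀ t a {w w′ : Word m} → length w ≡ length w′ → T t (a ∷ w) - T t (a ∷ w′) ≡ T t w - T t w′
    T-prep t a {w} {w′} same rewrite same = cancel (Ψ t [ a ] * + length w′) (T t w) (T t w′)
      where
      cancel : ∀ p x y → (p + x) - (p + y) ≡ x - y
      cancel = solve-∀

    T-swap : ∀ t a b {w w′ : Word m} → length w ≡ length w′ →
             T t (a ∷ b ∷ w) - T t (b ∷ a ∷ w′) ≡ (Ψ t [ a ] - Ψ t [ b ]) + (T t w - T t w′)
    T-swap t a b {w} {w′} same rewrite same = cancel (Ψ t [ a ]) (Ψ t [ b ]) (+ length w′) (T t w) (T t w′)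
      where
      cancel : ∀ p q l x y → (p * (1ℤ + l) + (q * l + x)) - (q * (1ℤ + l) + (p * l + y)) ≡ (p - q) + (x - y)
      cancel = solve-∀

    LinearOnRuns : ℕ → ℤ → Set
    LinearOnRuns k β = ∀ (x y : Word m) → length x ≡ length y → ∀ s →
      Δ (σ^ m k x) (σ^ m k y) (run s (suc k)) ≡ β * (+ occ x (s +ₘ k) - + occ y (s +ₘ k))

    pair-σ-∷ : ∀ s a (x : Word m) →
      binomℤ (σ m (a ∷ x)) (s ∷ s +ₘ 1 ∷ []) + + occ (a ∷ x) (s +ₘ 1) ≡
      binomℤ (σ m x) (s ∷ s +ₘ 1 ∷ []) + + occ x (s +ₘ 1) + + suc (length x)
    pair-σ-∷ s a x = begin
      binomℤ (σ-letter m a ++ σ m x) pair + + occ (a ∷ x) (s +ₘ 1)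
        ≡⟨ cong₂ _+_ (binomℤ-++ (σ-letter m a) (σ m x) pair) (+occ-++ [ a ] x (s +ₘ 1)) ⟩
      1ℤ * S pair + (R [ s ] * S [ s +ₘ 1 ] + R pair * 1ℤ) + (A + X)
        ≡⟨ cong₂ (λ p q → 1ℤ * S pair + (+ p * + q + R pair * 1ℤ) + (A + X)) (occ-σ-letter a s) (occ-σ x (s +ₘ 1)) ⟩
      1ℤ * S pair + (1ℤ * + length x + R pair * 1ℤ) + (A + X)
        ≡⟨ regroup (S pair) (+ length x) (R pair) A X ⟩
      S pair + X + (1ℤ + + length x) + (R pair + A - 1ℤ)
        ≡⟨ cong (λ p → S pair + X + (1ℤ + + length x) + (p - 1ℤ)) R+A≡1 ⟩
      S pair + X + (1ℤ + + length x) + (1ℤ - 1ℤ)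
        ≡⟨ cancel (S pair + X + (1ℤ + + length x)) ⟩
      S pair + X + + suc (length x) ∎
      where
      pair = s ∷ s +ₘ 1 ∷ []
      R S : Word m → ℤ
      R = binomℤ (σ-letter m a)
      S = binomℤ (σ m x)
      A = + occ [ a ] (s +ₘ 1)
      X = + occ x (s +ₘ 1)
      occ-σ-letter : ∀ a c → occ (σ-letter m a) c ≡ 1
      occ-σ-letter a c = trans (cong (λ w → occ w c) (σ-letter≡run a)) (occ-run a c)
      R+A≡1 : R pair + A ≡ 1ℤ
      R+A≡1 = begin
        R pair + A                                        ≡⟨ pos-+ (binom (σ-letter m a) pair) (occ [ a ] (s +ₘ 1)) ⟨
        + (binom (σ-letter m a) pair ℕ.+ occ [ a ] (s +ₘ 1))
          ≡⟨ cong (λ w → + (binom w pair ℕ.+ occ [ a ] (s +ₘ 1))) (σ-letter≡run a) ⟩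
        + (binom (run a m) pair ℕ.+ occ [ a ] (s +ₘ 1))     ≡⟨ cong +_ (pair-run a s) ⟩
        1ℤ                                                ∎
      regroup : ∀ p l r a x → 1ℤ * p + (1ℤ * l + r * 1ℤ) + (a + x) ≡ p + x + (1ℤ + l) + (r + a - 1ℤ)
      regroup = solve-∀
      cancel : ∀ p → p + (1ℤ - 1ℤ) ≡ p
      cancel = solve-∀

    pair-σ-length : ∀ s (x y : Word m) → length x ≡ length y →
      binomℤ (σ m x) (s ∷ s +ₘ 1 ∷ []) + + occ x (s +ₘ 1) ≡
      binomℤ (σ m y) (s ∷ s +ₘ 1 ∷ []) + + occ y (s +ₘ 1)
    pair-σ-length s []      []      _    = refl
    pair-σ-length s (a ∷ x) (b ∷ y) same = begin
      binomℤ (σ m (a ∷ x)) pair + + occ (a ∷ x) (s +ₘ 1)          ≡⟨ pair-σ-∷ s a x ⟩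
      binomℤ (σ m x) pair + + occ x (s +ₘ 1) + + suc (length x)
        ≡⟨ cong₂ (λ p l → p + + suc l) (pair-σ-length s x y same′) same′ ⟩
      binomℤ (σ m y) pair + + occ y (s +ₘ 1) + + suc (length y)  ≡⟨ pair-σ-∷ s b y ⟨
      binomℤ (σ m (b ∷ y)) pair + + occ (b ∷ y) (s +ₘ 1)          ∎
      where
      pair = s ∷ s +ₘ 1 ∷ []
      same′ = suc-injective same

    linearOnRuns-1 : LinearOnRuns 1 (- 1ℤ)
    linearOnRuns-1 x y same s = begin
      X - Y                         ≡⟨ shift X Y A B ⟩
      ((X + A) - (Y + B)) - (A - B) ≡⟨ cong (_- (A - B)) (i≡j⇒i-j≡0 (pair-σ-length s x y same)) ⟩
      0ℤ - (A - B)                  ≡⟨ negate A B ⟩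
      - 1ℤ * (A - B)                ∎
      where
      X = binomℤ (σ m x) (s ∷ s +ₘ 1 ∷ [])
      Y = binomℤ (σ m y) (s ∷ s +ₘ 1 ∷ [])
      A = + occ x (s +ₘ 1)
      B = + occ y (s +ₘ 1)
      shift : ∀ x y a b → x - y ≡ ((x + a) - (y + b)) - (a - b)
      shift = solve-∀
      negate : ∀ a b → 0ℤ - (a - b) ≡ - 1ℤ * (a - b)
      negate = solve-∀

    module _ {j : ℕ} {β : ℤ} (linear : LinearOnRuns (suc j) β) where
      private
        N : ℤ
        N = + (m ^ j)

        below-run : ∀ {u v : Word m} s ℓ → u ∼[ ℓ ] v → VanishesBelow (length (run s (suc ℓ))) (Δ u v)
        below-run {u} {v} s ℓ u∼v =
          subst (λ L → VanishesBelow L (Δ u v)) (sym (length-run s (suc ℓ))) (∼⇒vanishes u∼v)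

      Δ-σ^-swap-letters : ∀ s (a b : Fin m) →
        let U = σ^ m (suc j) [ a ]; V = σ^ m (suc j) [ b ] in
        Δ (U ++ V) (V ++ U) (run s (suc (suc (suc j)))) ≡ N * β * (Ψ (s +ₘ suc j) [ a ] - Ψ (s +ₘ suc j) [ b ])
      Δ-σ^-swap-letters s a b = begin
        Δ (U ++ V) (V ++ U) (s ∷ run (s +ₘ 1) (suc k))
          ≡⟨ Δ-++-comm-leading U V (run s (suc k)) (run (s +ₘ 1) (suc k)) (below-run s k (σ^-letters-∼ k a b))
                            (trans (length-run (s +ₘ 1) (suc k)) (sym (length-run s (suc k)))) (run-∷ʳ s (suc k)) ⟩
        Δ U V (run s (suc k)) * + occ V (s +ₘ suc k) - + occ V s * Δ U V (run (s +ₘ 1) (suc k))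
          ≡⟨ cong₂ (λ p q → p * + occ V (s +ₘ suc k) - + occ V s * q)
                   (linear [ a ] [ b ] refl s) (linear [ a ] [ b ] refl (s +ₘ 1)) ⟩
        β * (+ occ [ a ] t - + occ [ b ] t) * + occ V (s +ₘ suc k) - + occ V s * (β * (+ occ [ a ] t′ - + occ [ b ] t′))
          ≡⟨ cong₂ (λ p q → β * (+ occ [ a ] t - + occ [ b ] t) * p - q * (β * (+ occ [ a ] t′ - + occ [ b ] t′)))
                   (occ-letter (s +ₘ suc k)) (occ-letter s) ⟩
        β * (+ occ [ a ] t - + occ [ b ] t) * N - N * (β * (+ occ [ a ] t′ - + occ [ b ] t′))
          ≡⟨ cong (λ c → β * (+ occ [ a ] t - + occ [ b ] t) * N - N * (β * (+ occ [ a ] c - + occ [ b ] c))) t′≡t+1 ⟩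
        β * (+ occ [ a ] t - + occ [ b ] t) * N - N * (β * (+ occ [ a ] (t +ₘ 1) - + occ [ b ] (t +ₘ 1)))
          ≡⟨ regroup N β (+ occ [ a ] t) (+ occ [ b ] t) (+ occ [ a ] (t +ₘ 1)) (+ occ [ b ] (t +ₘ 1)) ⟩
        N * β * (Ψ t [ a ] - Ψ t [ b ]) ∎
        where
        k = suc j
        t = s +ₘ k
        t′ = (s +ₘ 1) +ₘ k
        t′≡t+1 : t′ ≡ t +ₘ 1
        t′≡t+1 = trans (+ₘ-assoc s 1 k) (sym (+ₘ-suc s k))
        U V : Word m
        U = σ^ m k [ a ]
        V = σ^ m k [ b ]
        occ-letter : ∀ c → + occ V c ≡ N
        occ-letter c = cong +_ (trans (occ-σ^ j [ b ] c) (*-identityʳ (m ^ j)))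
        regroup : ∀ n β p q p′ q′ → β * (p - q) * n - n * (β * (p′ - q′)) ≡ n * β * ((p - p′) - (q - q′))
        regroup = solve-∀

      Δ-σ^-↭ : ∀ s {w w′ : Word m} → w ↭ w′ →
        Δ (σ^ m (suc j) w) (σ^ m (suc j) w′) (run s (suc (suc (suc j)))) ≡
        N * β * (T (s +ₘ suc j) w - T (s +ₘ suc j) w′)
      Δ-σ^-↭ s {w} ↭.refl = trans (Δ-self (σ^ m (suc j) w) (run s (suc (suc (suc j))))) (vanish N β (T (s +ₘ suc j) w))
        where
        vanish : ∀ n β x → 0ℤ ≡ n * β * (x - x)
        vanish = solve-∀
      Δ-σ^-↭ s {a ∷ w} {.a ∷ w′} (↭.prep a p) = begin
        Δ (σ^ m k (a ∷ w)) (σ^ m k (a ∷ w′)) z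
          ≡⟨ cong₂ (λ p q → Δ p q z) (σ^-++ k [ a ] w) (σ^-++ k [ a ] w′) ⟩
        Δ (U ++ W) (U ++ W′) z
          ≡⟨ Δ-++ U U W W′ z (λ v _ → Δ-self U v) (below-run s (suc k) (σ^-↭-∼ k p)) ⟩
        Δ U U z + Δ W W′ z                         ≡⟨ cong₂ _+_ (Δ-self U z) (Δ-σ^-↭ s p) ⟩
        0ℤ + N * β * (T t w - T t w′)              ≡⟨ +-identityˡ _ ⟩
        N * β * (T t w - T t w′)                   ≡⟨ cong (_*_ (N * β)) (T-prep t a {w} {w′} (↭-length p)) ⟨
        N * β * (T t (a ∷ w) - T t (a ∷ w′))       ∎
        where
        k = suc j
        t = s +ₘ k
        z = run s (suc (suc k))
        U = σ^ m k [ a ]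
        W = σ^ m k w
        W′ = σ^ m k w′
      Δ-σ^-↭ s {a ∷ b ∷ w} {.b ∷ .a ∷ w′} (↭.swap a b p) = begin
        Δ (σ^ m k (a ∷ b ∷ w)) (σ^ m k (b ∷ a ∷ w′)) z
          ≡⟨ cong₂ (λ p q → Δ p q z) (σ^-∷-∷ k a b w) (σ^-∷-∷ k b a w′) ⟩
        Δ ((U ++ V) ++ W) ((V ++ U) ++ W′) z
          ≡⟨ Δ-++ (U ++ V) (V ++ U) W W′ z (below-run s (suc k) (∼-swap (σ^-letters-∼ k a b)))
                                           (below-run s (suc k) (σ^-↭-∼ k p)) ⟩
        Δ (U ++ V) (V ++ U) z + Δ W W′ z
          ≡⟨ cong₂ _+_ (Δ-σ^-swap-letters s a b) (Δ-σ^-↭ s p) ⟩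
        N * β * (Ψ t [ a ] - Ψ t [ b ]) + N * β * (T t w - T t w′)
          ≡⟨ distrib (N * β) (Ψ t [ a ] - Ψ t [ b ]) (T t w - T t w′) ⟩
        N * β * ((Ψ t [ a ] - Ψ t [ b ]) + (T t w - T t w′))
          ≡⟨ cong (_*_ (N * β)) (T-swap t a b {w} {w′} (↭-length p)) ⟨
        N * β * (T t (a ∷ b ∷ w) - T t (b ∷ a ∷ w′)) ∎
        where
        k = suc j
        t = s +ₘ k
        z = run s (suc (suc k))
        U = σ^ m k [ a ]
        V = σ^ m k [ b ]
        W = σ^ m k w
        W′ = σ^ m k w′
        distrib : ∀ p x y → p * x + p * y ≡ p * (x + y)
        distrib = solve-∀
      Δ-σ^-↭ s {w} {w″} (↭.trans {ys = w′} p q) = begin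
        Δ X Z z                                            ≡⟨ telescope (binomℤ X z) (binomℤ Y z) (binomℤ Z z) ⟩
        Δ X Y z + Δ Y Z z                                  ≡⟨ cong₂ _+_ (Δ-σ^-↭ s p) (Δ-σ^-↭ s q) ⟩
        N * β * (T t w - T t w′) + N * β * (T t w′ - T t w″) ≡⟨ telescope′ (N * β) (T t w) (T t w′) (T t w″) ⟩
        N * β * (T t w - T t w″)                            ∎
        where
        k = suc j
        t = s +ₘ k
        z = run s (suc (suc k))
        X = σ^ m k w
        Y = σ^ m k w′
        Z = σ^ m k w″
        telescope : ∀ x y z → x - z ≡ (x - y) + (y - z)
        telescope = solve-∀
        telescope′ : ∀ p x y z → p * (x - y) + p * (y - z) ≡ p * (x - z)
        telescope′ = solve-∀

      linearOnRuns-suc : LinearOnRuns (suc (suc j)) (- (+ (m ^ j) * (+ m * β)))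
      linearOnRuns-suc x y same s = begin
        Δ (σ^ m (suc k) x) (σ^ m (suc k) y) z
          ≡⟨ cong₂ (λ p q → Δ p q z) (σ^-suc k x) (σ^-suc k y) ⟩
        Δ (σ^ m k (σ m x)) (σ^ m k (σ m y)) z
          ≡⟨ Δ-σ^-↭ s (σ-↭ {x} {y} same) ⟩
        N * β * (T t (σ m x) - T t (σ m y))
          ≡⟨ cong₂ (λ p q → N * β * (p - q)) (T-σ t x) (T-σ t y) ⟩
        N * β * ((+ length x - + m * X) - (+ length y - + m * Y))
          ≡⟨ cong (λ l → N * β * ((+ length x - + m * X) - (+ l - + m * Y))) same ⟨
        N * β * ((+ length x - + m * X) - (+ length x - + m * Y))
          ≡⟨ regroup N β (+ length x) (+ m) X Y ⟩
        - (N * (+ m * β)) * (X - Y)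
          ≡⟨ cong (λ c → - (N * (+ m * β)) * (+ occ x c - + occ y c)) (+ₘ-suc s k) ⟩
        - (N * (+ m * β)) * (+ occ x (s +ₘ suc k) - + occ y (s +ₘ suc k)) ∎
        where
        k = suc j
        t = s +ₘ k
        z = run s (suc (suc k))
        X = + occ x (t +ₘ 1)
        Y = + occ y (t +ₘ 1)
        regroup : ∀ n β l m x y → n * β * ((l - m * x) - (l - m * y)) ≡ - (n * (m * β)) * (x - y)
        regroup = solve-∀

    private
      *-≢0 : ∀ {p q : ℤ} → p ≢ 0ℤ → q ≢ 0ℤ → p * q ≢ 0ℤ
      *-≢0 {p} p≢0 q≢0 = Sum.[ p≢0 , q≢0 ]′ ∘ i*j≡0⇒i≡0∨j≡0 p

      +≢0 : ∀ n .{{_ : NonZero n}} → + n ≢ 0ℤ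
      +≢0 n = ≢-nonZero⁻¹ n ∘ +-injective

    linearOnRuns : ∀ j → ∃[ β ] β ≢ 0ℤ × LinearOnRuns (suc j) β
    linearOnRuns zero = - 1ℤ , (λ ()) , linearOnRuns-1
    linearOnRuns (suc j) with β , β≢0 , linear ← linearOnRuns j =
      - (+ (m ^ j) * (+ m * β)) ,
      *-≢0 (+≢0 (m ^ j) {{m^n≢0 m j}}) (*-≢0 (+≢0 m) β≢0) ∘ neg-injective ,
      linearOnRuns-suc {j} linear

    ∼₁-of-σ^ : ∀ j (x y : Word m) → σ^ m (suc j) x ∼[ suc (suc j) ] σ^ m (suc j) y → x ∼[ 1 ] y
    ∼₁-of-σ^ j x y _       []          _         = refl
    ∼₁-of-σ^ j x y _       (_ ∷ _ ∷ _) (s≤s ())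
    ∼₁-of-σ^ j x y σx∼σy (c ∷ [])    _
      with β , β≢0 , linear ← linearOnRuns j
      = +-injective (subst (λ d → + occ x d ≡ + occ y d) (-ₘ-+ₘ c (suc j)) counts≡)
      where
      s = c -ₘ suc j
      same-length : length x ≡ length y
      same-length = *-cancelˡ-≡ (length x) (length y) (m ^ j) {{m^n≢0 m j}}
        (trans (sym (occ-σ^ j x c)) (trans (σx∼σy [ c ] (s≤s z≤n)) (occ-σ^ j y c)))
      β*diff≡0 : β * (+ occ x (s +ₘ suc j) - + occ y (s +ₘ suc j)) ≡ 0ℤ
      β*diff≡0 = trans (sym (linear x y same-length s))
                       (i≡j⇒i-j≡0 (cong +_ (σx∼σy (run s (suc (suc j))) (≤-reflexive (length-run s (suc (suc j)))))))
      counts≡ : + occ x (s +ₘ suc j) ≡ + occ y (s +ₘ suc j)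
      counts≡ with i*j≡0⇒i≡0∨j≡0 β β*diff≡0
      ... | inj₁ β≡0    = contradiction β≡0 β≢0
      ... | inj₂ diff≡0 = i-j≡0⇒i≡j _ _ diff≡0

proposition2p3 : (m : ℕ) → 2 ≤ m → (x y : Word m) → (k : ℕ) → 1 ≤ k → .{{_ : NonZero m}}
    → ((x ∼[ 1 ] y → (σ^ m k x) ∼[ suc k ] (σ^ m k y))
       × ((σ^ m k x) ∼[ suc k ] (σ^ m k y) → x ∼[ 1 ] y))
proposition2p3 m 1<m x y zero    ()
proposition2p3 m 1<m x y (suc j) _  = σ^-↭-∼ 1<m (suc j) ∘ ∼₁⇒↭ , ∼₁-of-σ^ 1<m j x y
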